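{- Let $n\ge1$ be an integer. For integers $m\ge0$ and $0\le k\le m$ put $a_{k,m}=2^k\,k!\prod_{l=1}^{k}(n+4m-2k-2l)$. The polynomials $p_m\in\mathbb{Q}[c^2]$ ($m\ge0$) that are implicitly (recursively) defined by \[ \sum_{k=0}^m\frac{p_{m-k}(c)}{a_{k,m}}=\frac{c^{2m}}{(2m)!}\qquad(m\ge0) \] are explicitly given by \[ p_m(c)=\sum_{k=0}^m\frac{(-1)^k c^{2m-2k}}{(2m-2k)!\,k!\,2^k\prod_{l=0}^{k-1}(n+4m-4-2l)}. \]
   Context: Empty products equal $1$; in particular $a_{0,m}=1$, so the defining relation determines $p_m$ recursively from $p_0,\dots,p_{m-1}$. -}

module Defs where

open import Data.Nat as ℕ using (ℕ; zero; suc; _∸_)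
open import Data.Nat using (_!)
open import Relation.Binary.PropositionalEquality using (_≡_)
open import Data.Integer using (+_)
open import Data.Rational using (ℚ; 0ℚ; 1ℚ; _+_; _*_; -_; _/_)

-- 1/d as a rational, for a natural number d.  (Only ever applied to
-- denominators that are provably positive; the value at 0 is a dummy.)
recip : ℕ → ℚ
recip zero    = 0ℚ
recip (suc d) = (+ 1) / suc d

pow : ℚ → ℕ → ℚ
pow c zero    = 1ℚ
pow c (suc k) = c * pow c k

negOnePow : ℕ → ℚ
negOnePow zero    = 1ℚ
negOnePow (suc k) = - negOnePow k

sumTo : ℕ → (ℕ → ℚ) → ℚ
sumTo zero    f = f 0
sumTo (suc m) f = sumTo m f + f (suc m)

prod1 : ℕ → (ℕ → ℕ) → ℕ
prod1 zero    f = 1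
prod1 (suc k) f = prod1 k f ℕ.* f (suc k)

prod0 : ℕ → (ℕ → ℕ) → ℕ
prod0 zero    f = 1
prod0 (suc k) f = prod0 k f ℕ.* f k

-- a_{k,m} = 2^k k! Π_{l=1}^{k} (n + 4m - 2k - 2l)
-- (for 0 ≤ l ≤ k ≤ m the subtraction is exact in ℕ)
a : ℕ → ℕ → ℕ → ℕ
a n k m = 2 ℕ.^ k ℕ.* (k !) ℕ.* prod1 k (λ l → (n ℕ.+ 4 ℕ.* m) ∸ (2 ℕ.* k ℕ.+ 2 ℕ.* l))

Defining : ℕ → (ℕ → ℚ → ℚ) → Set
Defining n p = ∀ (m : ℕ) (c : ℚ) →
  sumTo m (λ k → p (m ∸ k) c * recip (a n k m)) ≡ pow c (2 ℕ.* m) * recip ((2 ℕ.* m) !)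

-- denominator of the k-th term of the explicit formula:
-- (2m-2k)! k! 2^k Π_{l=0}^{k-1} (n + 4m - 4 - 2l)
-- (for 0 ≤ l ≤ k-1 ≤ m-1 the subtraction is exact in ℕ)
explicitDen : ℕ → ℕ → ℕ → ℕ
explicitDen n m k =
  ((2 ℕ.* m ∸ 2 ℕ.* k) !) ℕ.* (k !) ℕ.* 2 ℕ.^ k
    ℕ.* prod0 k (λ l → (n ℕ.+ 4 ℕ.* m) ∸ (4 ℕ.+ 2 ℕ.* l))

explicit : ℕ → ℕ → ℚ → ℚ
explicit n m c =
  sumTo m (λ k → negOnePow k * pow c (2 ℕ.* m ∸ 2 ℕ.* k) * recip (explicitDen n m k))

-- Since a_{0,m} = 1, the defining relation determines p_m from p_0, …, p_{m-1}, so it is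
-- enough to check that the explicit polynomials satisfy it.  Substituting them and
-- collecting powers of c, the coefficient of c^{2m-2j} is 1 / ((2m-2j)! 2^j) times
-- Σ_{k≤j} (-1)^{j-k} / termDen_j(k), where termDen_j(k) = (j-k)! k! Π_{i≤j, i≠k} (N - 2(k+1+i))
-- with N = n + 4m.  For j = 0 this is 1; for j ≥ 1 it telescopes to 0, because
-- 1/termDen_j(k) = 1/splitDen_j(k) + 1/splitDen_j(k+1) for 0 < k < j, while the boundary
-- terms are 1/splitDen_j(1) and 1/splitDen_j(j).

module Submission where

open import Defs
open import Relation.Binary.PropositionalEquality

module Denominators where
  open import Data.Nat
  open import Data.Nat.Properties
  open import Data.Nat.Tactic.RingSolver using (solve-∀)

  *-pos : ∀ {x y} → 0 < x → 0 < y → 0 < x * y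
  *-pos {suc x} {suc y} _ _ = s≤s z≤n

  [m∸o]∸[n∸o]≡m∸n : ∀ m {n o} → o ≤ n → (m ∸ o) ∸ (n ∸ o) ≡ m ∸ n
  [m∸o]∸[n∸o]≡m∸n m {n} {o} o≤n = trans (∸-+-assoc m o (n ∸ o)) (cong (m ∸_) (m+[n∸m]≡n o≤n))

  2[m∸o]∸2[n∸o]≡2m∸2n : ∀ m {n o} → o ≤ n → 2 * (m ∸ o) ∸ 2 * (n ∸ o) ≡ 2 * m ∸ 2 * n
  2[m∸o]∸2[n∸o]≡2m∸2n m {n} {o} o≤n = trans (cong₂ _∸_ (*-distribˡ-∸ 2 m o) (*-distribˡ-∸ 2 n o))
                                            ([m∸o]∸[n∸o]≡m∸n (2 * m) (*-monoʳ-≤ 2 o≤n))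

  ∸-shift : ∀ N x {d y} → x + d ≡ y → y ≤ N → N ∸ x ≡ (N ∸ y) + d
  ∸-shift N x {d} {y} x+d≡y y≤N = begin
    N ∸ x                   ≡⟨ cong (_∸ x) (sym (m∸n+n≡m y≤N)) ⟩
    (N ∸ y) + y ∸ x         ≡⟨ cong (λ v → (N ∸ y) + v ∸ x) (trans (sym x+d≡y) (+-comm x d)) ⟩
    (N ∸ y) + (d + x) ∸ x   ≡⟨ cong (_∸ x) (sym (+-assoc (N ∸ y) d x)) ⟩
    (N ∸ y) + d + x ∸ x     ≡⟨ m+n∸n≡m ((N ∸ y) + d) x ⟩
    (N ∸ y) + d             ∎
    where open ≡-Reasoning

  prod0-cong : ∀ t {f g : ℕ → ℕ} → (∀ i → i < t → f i ≡ g i) → prod0 t f ≡ prod0 t g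
  prod0-cong zero    f≗g = refl
  prod0-cong (suc t) f≗g = cong₂ _*_ (prod0-cong t (λ i i<t → f≗g i (m≤n⇒m≤1+n i<t))) (f≗g t ≤-refl)

  prod0-+ : ∀ u t (f : ℕ → ℕ) → prod0 (u + t) f ≡ prod0 u f * prod0 t (λ i → f (u + i))
  prod0-+ u zero    f = trans (cong (λ v → prod0 v f) (+-identityʳ u)) (sym (*-identityʳ _))
  prod0-+ u (suc t) f = begin
    prod0 (u + suc t) f                                ≡⟨ cong (λ v → prod0 v f) (+-suc u t) ⟩
    prod0 (u + t) f * f (u + t)                        ≡⟨ cong (_* f (u + t)) (prod0-+ u t f) ⟩
    prod0 u f * prod0 t (λ i → f (u + i)) * f (u + t)  ≡⟨ *-assoc (prod0 u f) _ _ ⟩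
    prod0 u f * prod0 (suc t) (λ i → f (u + i))        ∎
    where open ≡-Reasoning

  prod0-pos : ∀ t {f : ℕ → ℕ} → (∀ i → i < t → 0 < f i) → 0 < prod0 t f
  prod0-pos zero    f>0 = s≤s z≤n
  prod0-pos (suc t) f>0 = *-pos (prod0-pos t (λ i i<t → f>0 i (m≤n⇒m≤1+n i<t))) (f>0 t ≤-refl)

  prod1≡prod0-suc : ∀ k (f : ℕ → ℕ) → prod1 k f ≡ prod0 k (λ i → f (suc i))
  prod1≡prod0-suc zero    f = refl
  prod1≡prod0-suc (suc k) f = cong (_* f (suc k)) (prod1≡prod0-suc k f)

  fall₂ : ℕ → ℕ → ℕ → ℕ
  fall₂ N s t = prod0 t (λ i → N ∸ 2 * (s + i))

  fall₂-+ : ∀ N s u t → fall₂ N s (u + t) ≡ fall₂ N s u * fall₂ N (s + u) t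
  fall₂-+ N s u t = trans (prod0-+ u t _)
    (cong (fall₂ N s u *_) (prod0-cong t (λ i _ → cong (λ v → N ∸ 2 * v) (sym (+-assoc s u i)))))

  fall₂-suc : ∀ N s t → fall₂ N s (suc t) ≡ (N ∸ 2 * s) * fall₂ N (suc s) t
  fall₂-suc N s t = trans (fall₂-+ N s 1 t)
    (cong₂ _*_ (trans (*-identityˡ _) (cong (λ v → N ∸ 2 * v) (+-identityʳ s)))
               (cong (λ v → fall₂ N v t) (+-comm s 1)))

  -- The factor at position i = k of fall₂ N (suc k) (suc j) is left out.
  termDen : ℕ → ℕ → ℕ → ℕ
  termDen N j k = (j ∸ k) ! * k ! * fall₂ N (suc k) k * fall₂ N (suc (suc k + k)) (j ∸ k)

  splitDen : ℕ → ℕ → ℕ → ℕ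
  splitDen N j K = j * (j ∸ K) ! * (K ∸ 1) ! * fall₂ N (suc K) j

  splitDen-pos : ∀ {N j K} → 4 * j < N → 1 ≤ K → K ≤ j → 0 < splitDen N j K
  splitDen-pos {N} {j} {K} 4j<N 1≤K K≤j =
    *-pos (*-pos (*-pos (≤-trans 1≤K K≤j) (1≤n! (j ∸ K))) (1≤n! (K ∸ 1))) (prod0-pos j factor-pos)
    where
    factor-pos : ∀ i → i < j → 0 < N ∸ 2 * (suc K + i)
    factor-pos i i<j = m<n⇒0<n∸m (≤-<-trans bound 4j<N)
      where
      open ≤-Reasoning
      bound : 2 * (suc K + i) ≤ 4 * j
      bound = begin
        2 * (suc K + i) ≡⟨ cong (2 *_) (sym (+-suc K i)) ⟩
        2 * (K + suc i) ≤⟨ *-monoʳ-≤ 2 (+-mono-≤ K≤j i<j) ⟩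
        2 * (j + j)     ≡⟨ double-double j ⟩
        4 * j           ∎
        where
        double-double : ∀ j → 2 * (j + j) ≡ 4 * j
        double-double = solve-∀

  termDen-zero : ∀ N j → termDen N (suc j) 0 ≡ splitDen N (suc j) 1
  termDen-zero N j = cong (_* fall₂ N 2 (suc j)) (*-identityʳ (suc j ! * 1))

  termDen-top : ∀ N j → termDen N (suc j) (suc j) ≡ splitDen N (suc j) (suc j)
  termDen-top N j rewrite n∸n≡0 j = rearrange (suc j) (j !) (fall₂ N (suc (suc j)) (suc j))
    where
    rearrange : ∀ a b F → 1 * (a * b) * F * 1 ≡ a * 1 * b * F
    rearrange = solve-∀

  -- With k = suc κ, ρ = suc r and j = k + ρ, the numerators combine as
  -- ρ (b + 2j) + k b = j (b + 2ρ), and the hypothesis trades the factor b + 2ρ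
  -- for the ones the right-hand side needs.
  harmonic-algebra : ∀ κ r R K X Y Z b V →
    V ≡ (b + 2 * suc (suc κ + r)) * Z →
    X * ((b + 2 * suc r) * Y) ≡ (b + 2 * suc (suc κ + r)) * (Z * b) →
    suc r * R * (suc κ * K) * X * Y
        * (suc (suc κ + r) * (suc r * R) * K * V + suc (suc κ + r) * R * (suc κ * K) * (Z * b))
      ≡ suc (suc κ + r) * (suc r * R) * K * V * (suc (suc κ + r) * R * (suc κ * K) * (Z * b))
  harmonic-algebra κ r R K X Y Z b _ refl key =
    trans (expand κ r R K X Y Z b)
      (trans (cong ((suc (suc κ + r) * suc (suc κ + r) * suc r * suc κ * R * R * K * K * Z) *_) key)
             (collect κ r R K Z b))
    where
    expand : ∀ κ r R K X Y Z b →
      suc r * R * (suc κ * K) * X * Y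
          * (suc (suc κ + r) * (suc r * R) * K * ((b + 2 * suc (suc κ + r)) * Z)
             + suc (suc κ + r) * R * (suc κ * K) * (Z * b))
        ≡ (suc (suc κ + r) * suc (suc κ + r) * suc r * suc κ * R * R * K * K * Z)
          * (X * ((b + 2 * suc r) * Y))
    expand = solve-∀
    collect : ∀ κ r R K Z b →
      (suc (suc κ + r) * suc (suc κ + r) * suc r * suc κ * R * R * K * K * Z)
          * ((b + 2 * suc (suc κ + r)) * (Z * b))
        ≡ suc (suc κ + r) * (suc r * R) * K * ((b + 2 * suc (suc κ + r)) * Z)
          * (suc (suc κ + r) * R * (suc κ * K) * (Z * b))
    collect = solve-∀

  termDen-split : ∀ {N j} κ r → j ≡ suc (suc κ + r) → 4 * j ≤ N →
    termDen N j (suc κ) * (splitDen N j (suc κ) + splitDen N j (suc (suc κ)))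
      ≡ splitDen N j (suc κ) * splitDen N j (suc (suc κ))
  termDen-split {N} κ r refl 4j≤N
    -- j ∸ k ≡ suc r and j ∸ suc k ≡ r
    rewrite trans (cong (_∸ κ) (sym (+-suc κ r))) (m+n∸m≡n κ (suc r)) | m+n∸m≡n (suc κ) r =
    harmonic-algebra κ r (r !) (κ !) X Y Z b (fall₂ N (suc k) j) head key
    where
    k j b X Y Z : ℕ
    k = suc κ
    j = suc (k + r)
    b = N ∸ 2 * (suc (suc k) + (k + r))
    X = fall₂ N (suc k) k
    Y = fall₂ N (suc (suc k + k)) (suc r)
    Z = fall₂ N (suc (suc k)) (k + r)

    bound : 2 * (suc (suc k) + (k + r)) ≤ N
    bound = ≤-trans (m≤m+n _ (2 * r)) (subst (_≤ N) (sym (identity κ r)) 4j≤N)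
      where
      identity : ∀ κ r → 2 * (suc (suc (suc κ)) + (suc κ + r)) + 2 * r ≡ 4 * suc (suc κ + r)
      identity = solve-∀

    outer : N ∸ 2 * suc k ≡ b + 2 * j
    outer = ∸-shift N (2 * suc k) (identity κ r) bound
      where
      identity : ∀ κ r → 2 * suc (suc κ) + 2 * suc (suc κ + r) ≡ 2 * (suc (suc (suc κ)) + (suc κ + r))
      identity = solve-∀

    inner : N ∸ 2 * (suc k + k) ≡ b + 2 * suc r
    inner = ∸-shift N (2 * (suc k + k)) (identity κ r) bound
      where
      identity : ∀ κ r → 2 * (suc (suc κ) + suc κ) + 2 * suc r ≡ 2 * (suc (suc (suc κ)) + (suc κ + r))
      identity = solve-∀

    head : fall₂ N (suc k) j ≡ (b + 2 * j) * Z
    head = trans (fall₂-suc N (suc k) (k + r)) (cong (_* Z) outer)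

    key : X * ((b + 2 * suc r) * Y) ≡ (b + 2 * j) * (Z * b)
    key = begin
      X * ((b + 2 * suc r) * Y)              ≡⟨ cong (λ v → X * (v * Y)) (sym inner) ⟩
      X * ((N ∸ 2 * (suc k + k)) * Y)        ≡⟨ cong (X *_) (sym (fall₂-suc N (suc k + k) (suc r))) ⟩
      X * fall₂ N (suc k + k) (suc (suc r))  ≡⟨ sym (fall₂-+ N (suc k) k (suc (suc r))) ⟩
      fall₂ N (suc k) (k + suc (suc r))
        ≡⟨ cong (fall₂ N (suc k)) (trans (+-suc k (suc r)) (cong suc (+-suc k r))) ⟩
      fall₂ N (suc k) (suc j)                ≡⟨ fall₂-suc N (suc k) j ⟩
      (N ∸ 2 * suc k) * (Z * b)              ≡⟨ cong (_* (Z * b)) outer ⟩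
      (b + 2 * j) * (Z * b)                  ∎
      where open ≡-Reasoning

  explicitDen*a : ∀ n {m j k} → k ≤ j → j ≤ m →
    explicitDen n (m ∸ k) (j ∸ k) * a n k m ≡ (2 * m ∸ 2 * j) ! * 2 ^ j * termDen (n + 4 * m) j k
  explicitDen*a n {m} {j} {k} k≤j j≤m = begin
      (2 * (m ∸ k) ∸ 2 * (j ∸ k)) ! * (j ∸ k) ! * 2 ^ (j ∸ k) * prod0 (j ∸ k) upper
        * (2 ^ k * k ! * prod1 k lower)
    ≡⟨ cong₂ (λ e y → e ! * (j ∸ k) ! * 2 ^ (j ∸ k) * y * (2 ^ k * k ! * prod1 k lower))
              (2[m∸o]∸2[n∸o]≡2m∸2n m k≤j) upper≡ ⟩
      (2 * m ∸ 2 * j) ! * (j ∸ k) ! * 2 ^ (j ∸ k) * Y * (2 ^ k * k ! * prod1 k lower)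
    ≡⟨ cong (λ x → (2 * m ∸ 2 * j) ! * (j ∸ k) ! * 2 ^ (j ∸ k) * Y * (2 ^ k * k ! * x)) lower≡ ⟩
      (2 * m ∸ 2 * j) ! * (j ∸ k) ! * 2 ^ (j ∸ k) * Y * (2 ^ k * k ! * X)
    ≡⟨ rearrange ((2 * m ∸ 2 * j) !) ((j ∸ k) !) (2 ^ (j ∸ k)) Y (2 ^ k) (k !) X ⟩
      (2 * m ∸ 2 * j) ! * (2 ^ (j ∸ k) * 2 ^ k) * termDen N j k
    ≡⟨ cong (λ t → (2 * m ∸ 2 * j) ! * t * termDen N j k) powers ⟩
      (2 * m ∸ 2 * j) ! * 2 ^ j * termDen N j k
    ∎
    where
    open ≡-Reasoning
    N X Y : ℕ
    N = n + 4 * m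
    X = fall₂ N (suc k) k
    Y = fall₂ N (suc (suc k + k)) (j ∸ k)
    upper lower : ℕ → ℕ
    upper l = (n + 4 * (m ∸ k)) ∸ (4 + 2 * l)
    lower l = N ∸ (2 * k + 2 * l)

    upper≡ : prod0 (j ∸ k) upper ≡ Y
    upper≡ = prod0-cong (j ∸ k) λ l _ → trans
      (sym ([m+n]∸[m+o]≡n∸o (4 * k) _ (4 + 2 * l)))
      (cong₂ _∸_ (trans (shift n (m ∸ k) k) (cong (λ u → n + 4 * u) (m∸n+n≡m (≤-trans k≤j j≤m))))
                 (shift′ k l))
      where
      shift : ∀ n u k → 4 * k + (n + 4 * u) ≡ n + 4 * (u + k)
      shift = solve-∀
      shift′ : ∀ k l → 4 * k + (4 + 2 * l) ≡ 2 * (suc (suc k + k) + l)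
      shift′ = solve-∀

    lower≡ : prod1 k lower ≡ X
    lower≡ = trans (prod1≡prod0-suc k lower) (prod0-cong k λ i _ → cong (N ∸_) (shift k i))
      where
      shift : ∀ k i → 2 * k + 2 * suc i ≡ 2 * (suc k + i)
      shift = solve-∀

    rearrange : ∀ B F P Y Q K X → B * F * P * Y * (Q * K * X) ≡ B * (P * Q) * (F * K * X * Y)
    rearrange = solve-∀

    powers : 2 ^ (j ∸ k) * 2 ^ k ≡ 2 ^ j
    powers = trans (sym (^-distribˡ-+-* 2 (j ∸ k) k)) (cong (2 ^_) (m∸n+n≡m k≤j))

open Denominators
open import Data.Nat as ℕ using (ℕ; zero; suc; _∸_; _≤_; _<_; z≤n; s≤s; _!)
import Data.Nat.Properties as ℕ
open import Data.Integer using (+_)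
open import Data.Rational using (ℚ; 0ℚ; 1ℚ; _+_; _*_; -_; toℚᵘ)
open import Data.Rational.Properties
  using (toℚᵘ-injective; toℚᵘ-fromℚᵘ; toℚᵘ-homo-+; toℚᵘ-homo-*;
         +-identityˡ; +-identityʳ; +-assoc; +-inverseˡ; +-0-group;
         *-assoc; *-identityˡ; *-identityʳ; *-zeroˡ; *-zeroʳ;
         *-distribˡ-+; *-distribʳ-+; neg-distrib-+; neg-distribˡ-*)
import Data.Rational.Unnormalised as ℚᵘ
import Data.Rational.Unnormalised.Properties as ℚᵘ
open import Data.Rational.Solver using (module +-*-Solver)
open import Data.Nat.Tactic.RingSolver using (solve-∀)
open import Algebra.Properties.Group +-0-group using (∙-cancelʳ)
open +-*-Solver using (solve; _:=_; _:+_; _:*_; :-_; con)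

toℚᵘ-recip : ∀ d → toℚᵘ (recip (suc d)) ℚᵘ.≃ ℚᵘ.mkℚᵘ (+ 1) d
toℚᵘ-recip d = toℚᵘ-fromℚᵘ (ℚᵘ.mkℚᵘ (+ 1) d)

recip-* : ∀ x y → recip (x ℕ.* y) ≡ recip x * recip y
recip-* zero    y       = sym (*-zeroˡ (recip y))
recip-* (suc x) zero    = trans (cong recip (ℕ.*-zeroʳ x)) (sym (*-zeroʳ (recip (suc x))))
recip-* (suc x) (suc y) = toℚᵘ-injective (begin
  toℚᵘ (recip (suc x ℕ.* suc y))                 ≈⟨ toℚᵘ-recip (y ℕ.+ x ℕ.* suc y) ⟩
  ℚᵘ.mkℚᵘ (+ 1) x ℚᵘ.* ℚᵘ.mkℚᵘ (+ 1) y           ≈⟨ ℚᵘ.*-cong (toℚᵘ-recip x) (toℚᵘ-recip y) ⟨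
  toℚᵘ (recip (suc x)) ℚᵘ.* toℚᵘ (recip (suc y)) ≈⟨ toℚᵘ-homo-* (recip (suc x)) (recip (suc y)) ⟨
  toℚᵘ (recip (suc x) * recip (suc y))           ∎)
  where open ℚᵘ.≃-Reasoning

recip-harmonic : ∀ {x y d} → 0 < x → 0 < y → d ℕ.* (x ℕ.+ y) ≡ x ℕ.* y →
                 recip x + recip y ≡ recip d
recip-harmonic {suc x} {suc y} {zero}  _ _ ()
recip-harmonic {suc x} {suc y} {suc d} _ _ d[x+y]≡xy = toℚᵘ-injective (begin
  toℚᵘ (recip (suc x) + recip (suc y))           ≈⟨ toℚᵘ-homo-+ (recip (suc x)) (recip (suc y)) ⟩
  toℚᵘ (recip (suc x)) ℚᵘ.+ toℚᵘ (recip (suc y)) ≈⟨ ℚᵘ.+-cong (toℚᵘ-recip x) (toℚᵘ-recip y) ⟩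
  ℚᵘ.mkℚᵘ (+ 1) x ℚᵘ.+ ℚᵘ.mkℚᵘ (+ 1) y           ≈⟨ ℚᵘ.*≡* (cong +_ cross) ⟩
  ℚᵘ.mkℚᵘ (+ 1) d                                ≈⟨ toℚᵘ-recip d ⟨
  toℚᵘ (recip (suc d))                           ∎)
  where
  open ℚᵘ.≃-Reasoning
  cross : (1 ℕ.* suc y ℕ.+ 1 ℕ.* suc x) ℕ.* suc d ≡ 1 ℕ.* (suc x ℕ.* suc y)
  cross = trans (commute (suc x) (suc y) (suc d)) (trans d[x+y]≡xy (sym (ℕ.*-identityˡ _)))
    where
    commute : ∀ a b c → (1 ℕ.* b ℕ.+ 1 ℕ.* a) ℕ.* c ≡ c ℕ.* (a ℕ.+ b)
    commute = solve-∀

sumTo-cong : ∀ m {f g : ℕ → ℚ} → (∀ k → k ≤ m → f k ≡ g k) → sumTo m f ≡ sumTo m g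
sumTo-cong zero    f≗g = f≗g 0 z≤n
sumTo-cong (suc m) f≗g =
  cong₂ _+_ (sumTo-cong m (λ k k≤m → f≗g k (ℕ.m≤n⇒m≤1+n k≤m))) (f≗g (suc m) ℕ.≤-refl)

sumTo-+ : ∀ m (f g : ℕ → ℚ) → sumTo m (λ k → f k + g k) ≡ sumTo m f + sumTo m g
sumTo-+ zero    f g = refl
sumTo-+ (suc m) f g = trans (cong (_+ (f (suc m) + g (suc m))) (sumTo-+ m f g))
                            (interchange (sumTo m f) (sumTo m g) (f (suc m)) (g (suc m)))
  where
  interchange : ∀ a b c d → (a + b) + (c + d) ≡ (a + c) + (b + d)
  interchange = solve 4 (λ a b c d → (a :+ b) :+ (c :+ d) := (a :+ c) :+ (b :+ d)) refl

sumTo-neg : ∀ m (f : ℕ → ℚ) → sumTo m (λ k → - f k) ≡ - sumTo m f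
sumTo-neg zero    f = refl
sumTo-neg (suc m) f = trans (cong (_+ - f (suc m)) (sumTo-neg m f))
                            (sym (neg-distrib-+ (sumTo m f) (f (suc m))))

sumTo-*ˡ : ∀ m r (f : ℕ → ℚ) → r * sumTo m f ≡ sumTo m (λ k → r * f k)
sumTo-*ˡ zero    r f = refl
sumTo-*ˡ (suc m) r f = trans (*-distribˡ-+ r (sumTo m f) (f (suc m))) (cong (_+ r * f (suc m)) (sumTo-*ˡ m r f))

sumTo-*ʳ : ∀ m r (f : ℕ → ℚ) → sumTo m f * r ≡ sumTo m (λ k → f k * r)
sumTo-*ʳ zero    r f = refl
sumTo-*ʳ (suc m) r f = trans (*-distribʳ-+ r (sumTo m f) (f (suc m))) (cong (_+ f (suc m) * r) (sumTo-*ʳ m r f))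

sumTo-suc-head : ∀ m (f : ℕ → ℚ) → sumTo (suc m) f ≡ f 0 + sumTo m (λ k → f (suc k))
sumTo-suc-head zero    f = refl
sumTo-suc-head (suc m) f = trans (cong (_+ f (suc (suc m))) (sumTo-suc-head m f))
                                 (+-assoc (f 0) (sumTo m (λ k → f (suc k))) (f (suc (suc m))))

sumTo-concentrated : ∀ m (f : ℕ → ℚ) → (∀ j → suc j ≤ m → f (suc j) ≡ 0ℚ) → sumTo m f ≡ f 0
sumTo-concentrated zero    f f≡0 = refl
sumTo-concentrated (suc m) f f≡0 = trans
  (cong₂ _+_ (sumTo-concentrated m f (λ j j<m → f≡0 j (ℕ.m≤n⇒m≤1+n j<m))) (f≡0 m ℕ.≤-refl))
  (+-identityʳ (f 0))

sumTo-exchange : ∀ m (g : ℕ → ℕ → ℚ) →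
  sumTo m (λ k → sumTo (m ∸ k) (g k)) ≡ sumTo m (λ j → sumTo j (λ k → g k (j ∸ k)))
sumTo-exchange zero    g = refl
sumTo-exchange (suc m) g = begin
    sumTo m (λ k → sumTo (suc m ∸ k) (g k)) + sumTo (m ∸ m) (g (suc m))
  ≡⟨ cong₂ _+_ (sumTo-cong m (λ k k≤m → peel-last (ℕ.+-∸-assoc 1 k≤m)))
               (sumTo-zero (g (suc m)) (ℕ.n∸n≡0 m)) ⟩
    sumTo m (λ k → sumTo (m ∸ k) (g k) + g k (suc m ∸ k)) + g (suc m) (m ∸ m)
  ≡⟨ cong (_+ g (suc m) (m ∸ m)) (sumTo-+ m _ _) ⟩
    sumTo m (λ k → sumTo (m ∸ k) (g k)) + sumTo m (λ k → g k (suc m ∸ k)) + g (suc m) (m ∸ m)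
  ≡⟨ cong (λ s → s + sumTo m (λ k → g k (suc m ∸ k)) + g (suc m) (m ∸ m)) (sumTo-exchange m g) ⟩
    sumTo m (λ j → sumTo j (λ k → g k (j ∸ k))) + sumTo m (λ k → g k (suc m ∸ k)) + g (suc m) (m ∸ m)
  ≡⟨ +-assoc (sumTo m (λ j → sumTo j (λ k → g k (j ∸ k)))) _ _ ⟩
    sumTo m (λ j → sumTo j (λ k → g k (j ∸ k))) + sumTo (suc m) (λ k → g k (suc m ∸ k))
  ∎
  where
  open ≡-Reasoning
  peel-last : ∀ {k t u} → t ≡ suc u → sumTo t (g k) ≡ sumTo u (g k) + g k t
  peel-last refl = refl
  sumTo-zero : ∀ {t} h → t ≡ 0 → sumTo t h ≡ h t
  sumTo-zero h refl = refl

alternating-suc : ∀ j (d : ℕ → ℚ) →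
  sumTo (suc j) (λ k → negOnePow (suc j ∸ k) * d k)
    ≡ - sumTo j (λ k → negOnePow (j ∸ k) * d k) + d (suc j)
alternating-suc j d = cong₂ _+_
  (trans (sumTo-cong j λ k k≤j → trans (cong (λ t → negOnePow t * d k) (ℕ.+-∸-assoc 1 k≤j))
                                       (sym (neg-distribˡ-* (negOnePow (j ∸ k)) (d k))))
         (sumTo-neg j (λ k → negOnePow (j ∸ k) * d k)))
  (trans (cong (λ t → negOnePow t * d (suc j)) (ℕ.n∸n≡0 j)) (*-identityˡ (d (suc j))))

alternating-telescope : ∀ j (d e : ℕ → ℚ) → e 0 ≡ 0ℚ → (∀ k → k ≤ j → d k ≡ e k + e (suc k)) →
  sumTo j (λ k → negOnePow (j ∸ k) * d k) ≡ e (suc j)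
alternating-telescope zero d e e₀≡0 d≡e+e = begin
  1ℚ * d 0   ≡⟨ *-identityˡ (d 0) ⟩
  d 0        ≡⟨ d≡e+e 0 z≤n ⟩
  e 0 + e 1  ≡⟨ cong (_+ e 1) e₀≡0 ⟩
  0ℚ + e 1   ≡⟨ +-identityˡ (e 1) ⟩
  e 1        ∎
  where open ≡-Reasoning
alternating-telescope (suc j) d e e₀≡0 d≡e+e = begin
  sumTo (suc j) (λ k → negOnePow (suc j ∸ k) * d k)      ≡⟨ alternating-suc j d ⟩
  - sumTo j (λ k → negOnePow (j ∸ k) * d k) + d (suc j)
    ≡⟨ cong₂ (λ s t → - s + t) telescoped (d≡e+e (suc j) ℕ.≤-refl) ⟩
  - e (suc j) + (e (suc j) + e (suc (suc j)))            ≡⟨ cancel (e (suc j)) (e (suc (suc j))) ⟩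
  e (suc (suc j))                                        ∎
  where
  open ≡-Reasoning
  telescoped : sumTo j (λ k → negOnePow (j ∸ k) * d k) ≡ e (suc j)
  telescoped = alternating-telescope j d e e₀≡0 (λ k k≤j → d≡e+e k (ℕ.m≤n⇒m≤1+n k≤j))
  cancel : ∀ x y → - x + (x + y) ≡ y
  cancel = solve 2 (λ x y → :- x :+ (x :+ y) := y) refl

alternating-termDen : ∀ N j → 4 ℕ.* suc j < N →
  sumTo (suc j) (λ k → negOnePow (suc j ∸ k) * recip (termDen N (suc j) k)) ≡ 0ℚ
alternating-termDen N j 4j<N = begin
    sumTo (suc j) (λ k → negOnePow (suc j ∸ k) * d k)      ≡⟨ alternating-suc j d ⟩
    - sumTo j (λ k → negOnePow (j ∸ k) * d k) + d (suc j)
      ≡⟨ cong₂ (λ s t → - s + t) (alternating-telescope j d e refl split) top ⟩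
    - e (suc j) + e (suc j)                                ≡⟨ +-inverseˡ (e (suc j)) ⟩
    0ℚ                                                     ∎
  where
  open ≡-Reasoning
  d e : ℕ → ℚ
  d k = recip (termDen N (suc j) k)
  e zero    = 0ℚ
  e (suc K) = recip (splitDen N (suc j) (suc K))

  top : d (suc j) ≡ e (suc j)
  top = cong recip (termDen-top N j)

  split : ∀ k → k ≤ j → d k ≡ e k + e (suc k)
  split zero    _   = trans (cong recip (termDen-zero N j)) (sym (+-identityˡ (e 1)))
  split (suc κ) k≤j = sym (recip-harmonic {d = termDen N (suc j) (suc κ)}
    (splitDen-pos 4j<N (s≤s z≤n) (ℕ.m≤n⇒m≤1+n k≤j))
    (splitDen-pos 4j<N (s≤s z≤n) (s≤s k≤j))
    (termDen-split κ (j ∸ suc κ) (cong suc (sym (ℕ.m+[n∸m]≡n k≤j))) (ℕ.<⇒≤ 4j<N)))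

module Coefficients (n m : ℕ) (c : ℚ) where
  N : ℕ
  N = n ℕ.+ 4 ℕ.* m

  term : ℕ → ℕ → ℚ
  term k i = negOnePow i * pow c (2 ℕ.* (m ∸ k) ∸ 2 ℕ.* i) * recip (explicitDen n (m ∸ k) i)
             * recip (a n k m)

  coeff : ℕ → ℚ
  coeff j = sumTo j (λ k → term k (j ∸ k))

  term-factor : ∀ {j k} → k ≤ j → j ≤ m → term k (j ∸ k)
    ≡ pow c (2 ℕ.* m ∸ 2 ℕ.* j) * recip ((2 ℕ.* m ∸ 2 ℕ.* j) ! ℕ.* 2 ℕ.^ j)
        * (negOnePow (j ∸ k) * recip (termDen N j k))
  term-factor {j} {k} k≤j j≤m = begin
      σ * pow c (2 ℕ.* (m ∸ k) ∸ 2 ℕ.* (j ∸ k)) * recip E * recip A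
    ≡⟨ cong (λ e → σ * pow c e * recip E * recip A) (2[m∸o]∸2[n∸o]≡2m∸2n m k≤j) ⟩
      σ * P * recip E * recip A
    ≡⟨ *-assoc (σ * P) (recip E) (recip A) ⟩
      σ * P * (recip E * recip A)
    ≡⟨ cong (σ * P *_) (sym (recip-* E A)) ⟩
      σ * P * recip (E ℕ.* A)
    ≡⟨ cong (λ x → σ * P * recip x) (explicitDen*a n k≤j j≤m) ⟩
      σ * P * recip (B ℕ.* termDen N j k)
    ≡⟨ cong (σ * P *_) (recip-* B (termDen N j k)) ⟩
      σ * P * (recip B * recip (termDen N j k))
    ≡⟨ rearrange σ P (recip B) (recip (termDen N j k)) ⟩
      P * recip B * (σ * recip (termDen N j k))
    ∎
    where
    open ≡-Reasoning
    σ P : ℚ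
    σ = negOnePow (j ∸ k)
    P = pow c (2 ℕ.* m ∸ 2 ℕ.* j)
    E A B : ℕ
    E = explicitDen n (m ∸ k) (j ∸ k)
    A = a n k m
    B = (2 ℕ.* m ∸ 2 ℕ.* j) ! ℕ.* 2 ℕ.^ j
    rearrange : ∀ s p r t → s * p * (r * t) ≡ p * r * (s * t)
    rearrange = solve 4 (λ s p r t → s :* p :* (r :* t) := p :* r :* (s :* t)) refl

  coeff-suc≡0 : 1 ≤ n → ∀ j → suc j ≤ m → coeff (suc j) ≡ 0ℚ
  coeff-suc≡0 1≤n j j<m = begin
      coeff (suc j)                   ≡⟨ sumTo-cong (suc j) (λ k k≤j → term-factor k≤j j<m) ⟩
      sumTo (suc j) (λ k → P * (σ k)) ≡⟨ sumTo-*ˡ (suc j) P σ ⟨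
      P * sumTo (suc j) σ             ≡⟨ cong (P *_) (alternating-termDen N j 4j<N) ⟩
      P * 0ℚ                          ≡⟨ *-zeroʳ P ⟩
      0ℚ                              ∎
    where
    open ≡-Reasoning
    P : ℚ
    P = pow c (2 ℕ.* m ∸ 2 ℕ.* suc j) * recip ((2 ℕ.* m ∸ 2 ℕ.* suc j) ! ℕ.* 2 ℕ.^ suc j)
    σ : ℕ → ℚ
    σ k = negOnePow (suc j ∸ k) * recip (termDen N (suc j) k)
    4j<N : 4 ℕ.* suc j < N
    4j<N = ℕ.≤-<-trans (ℕ.*-monoʳ-≤ 4 j<m) (ℕ.m<n+m (4 ℕ.* m) 1≤n)

  -- coeff 0 is the single term k = i = 0, in which a n 0 m computes to 1 and
  -- explicitDen n m 0 to (2m)! * 1 * 1 * 1.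
  coeff-zero : coeff 0 ≡ pow c (2 ℕ.* m) * recip ((2 ℕ.* m) !)
  coeff-zero = trans (cong (λ x → 1ℚ * pow c (2 ℕ.* m) * recip x * 1ℚ) (*1*1*1 ((2 ℕ.* m) !)))
                     (strip-1 (pow c (2 ℕ.* m)) (recip ((2 ℕ.* m) !)))
    where
    *1*1*1 : ∀ x → x ℕ.* 1 ℕ.* 1 ℕ.* 1 ≡ x
    *1*1*1 x = trans (ℕ.*-identityʳ _) (trans (ℕ.*-identityʳ _) (ℕ.*-identityʳ x))
    strip-1 : ∀ p r → 1ℚ * p * r * 1ℚ ≡ p * r
    strip-1 = solve 2 (λ p r → con 1ℚ :* p :* r :* con 1ℚ := p :* r) refl

explicit-defining : ∀ n → 1 ≤ n → Defining n (explicit n)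
explicit-defining n 1≤n m c = begin
    sumTo m (λ k → explicit n (m ∸ k) c * recip (a n k m))
  ≡⟨ sumTo-cong m (λ k _ → sumTo-*ʳ (m ∸ k) (recip (a n k m)) _) ⟩
    sumTo m (λ k → sumTo (m ∸ k) (term k))
  ≡⟨ sumTo-exchange m term ⟩
    sumTo m coeff
  ≡⟨ sumTo-concentrated m coeff (coeff-suc≡0 1≤n) ⟩
    coeff 0
  ≡⟨ coeff-zero ⟩
    pow c (2 ℕ.* m) * recip ((2 ℕ.* m) !)
  ∎
  where
  open ≡-Reasoning
  open Coefficients n m c

*1-cancel : ∀ {x y} → x * 1ℚ ≡ y * 1ℚ → x ≡ y
*1-cancel {x} {y} eq = trans (sym (*-identityʳ x)) (trans eq (*-identityʳ y))

-- a n 0 m computes to 1, so the k = 0 summand of the defining relation is p m c * 1ℚ.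
defining-unique : ∀ n (p q : ℕ → ℚ → ℚ) → Defining n p → Defining n q →
  ∀ M m → m ≤ M → ∀ c → p m c ≡ q m c
defining-unique n p q dp dq M zero _ c = *1-cancel (trans (dp 0 c) (sym (dq 0 c)))
defining-unique n p q dp dq (suc M) (suc m) (s≤s m≤M) c = *1-cancel (∙-cancelʳ tail-q _ _ heads)
  where
  summand : (ℕ → ℚ → ℚ) → ℕ → ℚ
  summand r k = r (suc m ∸ k) c * recip (a n k (suc m))
  tail-q : ℚ
  tail-q = sumTo m (λ k → summand q (suc k))
  tails : sumTo m (λ k → summand p (suc k)) ≡ tail-q
  tails = sumTo-cong m (λ k _ → cong (_* recip (a n (suc k) (suc m)))
            (defining-unique n p q dp dq M (m ∸ k) (ℕ.≤-trans (ℕ.m∸n≤m m k) m≤M) c))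
  heads : p (suc m) c * 1ℚ + tail-q ≡ q (suc m) c * 1ℚ + tail-q
  heads = begin
    p (suc m) c * 1ℚ + tail-q                            ≡⟨ cong (λ t → p (suc m) c * 1ℚ + t) tails ⟨
    p (suc m) c * 1ℚ + sumTo m (λ k → summand p (suc k)) ≡⟨ sumTo-suc-head m (summand p) ⟨
    sumTo (suc m) (summand p)                            ≡⟨ dp (suc m) c ⟩
    pow c (2 ℕ.* suc m) * recip ((2 ℕ.* suc m) !)        ≡⟨ dq (suc m) c ⟨
    sumTo (suc m) (summand q)                            ≡⟨ sumTo-suc-head m (summand q) ⟩
    q (suc m) c * 1ℚ + tail-q                            ∎
    where open ≡-Reasoning

lemma5p4 : (n : ℕ) → 1 ≤ n → (p : ℕ → ℚ → ℚ) → Defining n p →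
           ∀ (m : ℕ) (c : ℚ) → p m c ≡ explicit n m c
lemma5p4 n 1≤n p dp m = defining-unique n p (explicit n) dp (explicit-defining n 1≤n) m m ℕ.≤-refl
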